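{- Let $\mathcal C\in\{\mathrm{ID},\mathrm{CD}\}$. The rule $(lft)$ is height-preserving admissible in $\mathsf{LBIQ}(\mathcal C)$: if $\mathcal R,\mathcal T,\Gamma,u:\varphi\vdash\Delta$ has a proof of height $n$ in $\mathsf{LBIQ}(\mathcal C)$ and $w\twoheadrightarrow^*_{\mathcal R}u$, then $\mathcal R,\mathcal T,\Gamma,w:\varphi\vdash\Delta$ has a proof of height at most $n$ in $\mathsf{LBIQ}(\mathcal C)$.
   Context: Syntax. Terms from variables and function symbols (constants have arity $0$); $\mathrm{Ter}(X)$ = terms with variables in $X$ (contains all constants), $\mathrm{Ter}=\mathrm{Ter}(\mathrm{Var})$, $\mathrm{VT}(t)$ variables of $t$, $\mathrm{VT}(\vec t)=\bigcup_i\mathrm{VT}(t_i)$. Formulae: $\varphi::=p(\vec t)\mid\bot\mid\top\mid\varphi\wedge\varphi\mid\varphi\vee\varphi\mid\varphi\mathbin{ -\!\!<}\varphi\mid\varphi\to\varphi\mid\exists x\varphi\mid\forall x\varphi$ ($\mathbin{ -\!\!<}$ exclusion); $\varphi(t/x)$ capture-avoiding substitution. Sequents. Labeled formula $w:\varphi$, relational atom $wRu$, domain atom $w:x$. A sequent is $\mathcal R,\mathcal T,\Gamma\vdash\Delta$ ($\mathcal R$ finite multiset of relational atoms, $\mathcal T$ of domain atoms, $\Gamma,\Delta$ of labeled formulae) with (1) if $\mathcal R\ne\emptyset$ every label in $\mathcal T,\Gamma,\Delta$ occurs in $\mathcal R$, and if $\mathcal R=\emptyset$ exactly one label occurs; (2)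 the directed graph of $\mathcal R$ connected without directed or undirected cycles. $w\twoheadrightarrow^*_{\mathcal R}u$ iff $w=u$ or there is a chain $wRv_1,\dots,v_nRu$ in $\mathcal R$. $X_w=\{x\mid u:x\in\mathcal T,\ u\twoheadrightarrow^*_{\mathcal R}w\}$; $t$ available for $w$ iff $t\in\mathrm{Ter}(X_w)$. Fresh = not occurring in the conclusion; side conditions evaluated in the conclusion. $\mathsf{LBIQ}(\mathrm{ID})$ (premises$\,/\,$conclusion, unchanged parts omitted): (ax) $\Gamma,w:p(\vec t)\vdash\Delta,u:p(\vec t)$ if $w\twoheadrightarrow^*_{\mathcal R}u$; $(\bot L)$ $\Gamma,w:\bot\vdash\Delta$; $(\top R)$ $\Gamma\vdash\Delta,w:\top$; $(\wedge L)$ $\Gamma,w:\varphi,w:\psi\vdash\Delta\,/\,\Gamma,w:\varphi\wedge\psi\vdash\Delta$; $(\wedge R)$ $\Gamma\vdash\Delta,w:\varphi$ and $\Gamma\vdash\Delta,w:\psi\,/\,\Gamma\vdash\Delta,w:\varphi\wedge\psi$; $(\vee L)$ $\Gamma,w:\varphi\vdash\Delta$ and $\Gamma,w:\psi\vdash\Delta\,/\,\Gamma,w:\varphi\vee\psi\vdash\Delta$; $(\vee R)$ $\Gamma\vdash\Delta,w:\varphi,w:\psi\,/\,\Gamma\vdash\Delta,w:\varphi\vee\psi$; $(\to L)$ $\Gamma,w:\varphi\to\psi\vdash\Delta,u:\varphi$ and $\Gamma,w:\varphi\to\psi,u:\psi\vdash\Delta\,/\,\Gamma,w:\varphi\to\psi\vdash\Delta$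 if $w\twoheadrightarrow^*_{\mathcal R}u$; $(\to R)$ $\mathcal R,wRu,\mathcal T,\Gamma,u:\varphi\vdash\Delta,u:\psi\,/\,\mathcal R,\mathcal T,\Gamma\vdash\Delta,w:\varphi\to\psi$, $u$ fresh; $(\mathbin{ -\!\!<}L)$ $\mathcal R,uRw,\mathcal T,\Gamma,u:\varphi\vdash\Delta,u:\psi\,/\,\mathcal R,\mathcal T,\Gamma,w:\varphi\mathbin{ -\!\!<}\psi\vdash\Delta$, $u$ fresh; $(\mathbin{ -\!\!<}R)$ $\Gamma\vdash\Delta,u:\varphi\mathbin{ -\!\!<}\psi,w:\varphi$ and $\Gamma,w:\psi\vdash\Delta,u:\varphi\mathbin{ -\!\!<}\psi\,/\,\Gamma\vdash\Delta,u:\varphi\mathbin{ -\!\!<}\psi$ if $w\twoheadrightarrow^*_{\mathcal R}u$; $(\exists L)$ $\mathcal R,\mathcal T,w:y,\Gamma,w:\varphi(y/x)\vdash\Delta\,/\,\mathcal R,\mathcal T,\Gamma,w:\exists x\varphi\vdash\Delta$, $y$ fresh; $(\exists R)$ $\Gamma\vdash\Delta,w:\exists x\varphi,w:\varphi(t/x)\,/\,\Gamma\vdash\Delta,w:\exists x\varphi$ if $t$ available for $w$; $(\forall L)$ $\Gamma,w:\forall x\varphi,u:\varphi(t/x)\vdash\Delta\,/\,\Gamma,w:\forall x\varphi\vdash\Delta$ if $w\twoheadrightarrow^*_{\mathcal R}u$ and $t$ available for $u$; $(\forall R)$ $\mathcal R,wRu,\mathcal T,u:y,\Gamma\vdash\Delta,u:\varphi(y/x)\,/\,\mathcal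 R,\mathcal T,\Gamma\vdash\Delta,w:\forall x\varphi$, $u,y$ fresh; $(ds)$ $\mathcal R,\mathcal T,w:\mathrm{VT}(\vec t),\Gamma,w:p(\vec t)\vdash\Delta\,/\,\mathcal R,\mathcal T,\Gamma,w:p(\vec t)\vdash\Delta$. $\mathsf{LBIQ}(\mathrm{CD})$: remove $(ds)$, allow any $t\in\mathrm{Ter}$ in $(\exists R)$ and $(\forall L)$ (keeping $w\twoheadrightarrow^*_{\mathcal R}u$ in $(\forall L)$). Proofs are finite trees of rule instances with leaves (ax), $(\bot L)$, $(\top R)$; height = length of the longest branch. Sequents differing by a bijective label renaming are regarded as mutually derivable. -}

module Defs where

open import Data.Nat using (ℕ; zero; suc; _≡ᵇ_; _⊔_; _≟_)
open import Data.Bool using (Bool; true; false; if_then_else_; _∨_)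
open import Data.List using (List; []; _∷_; _++_; map; concatMap; filter; foldr; length; lookup; deduplicate)
open import Data.List.Membership.Propositional using (_∈_; _∉_)
open import Data.List.Relation.Unary.All using (All)
open import Data.List.Relation.Unary.Unique.Propositional using (Unique)
open import Data.List.Relation.Binary.Permutation.Propositional using (_↭_)
open import Data.Product using (Σ; ∃; _×_; _,_; proj₁; proj₂)
open import Data.Fin using (Fin)
open import Data.Unit using (⊤)
open import Relation.Binary.PropositionalEquality using (_≡_; _≢_)
open import Relation.Nullary using (¬_; does)

data Term : Set where
  var : ℕ → Term
  fn  : ℕ → List Term → Term

mutual
  tvars : Term → List ℕ
  tvars (var x)   = x ∷ []
  tvars (fn f ts) = tsvars ts

  tsvars : List Term → List ℕ
  tsvars []       = []
  tsvars (t ∷ ts) = tvars t ++ tsvars ts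

mutual
  tsub : (ℕ → Term) → Term → Term
  tsub σ (var x)   = σ x
  tsub σ (fn f ts) = fn f (tssub σ ts)

  tssub : (ℕ → Term) → List Term → List Term
  tssub σ []       = []
  tssub σ (t ∷ ts) = tsub σ t ∷ tssub σ ts

infixr 10 _∧'_
infixr 9 _∨'_
infixr 8 _−<_
infixr 7 _⇒_

data Fm : Set where
  atom  : ℕ → List Term → Fm
  ⊥' ⊤' : Fm
  _∧'_ _∨'_ _−<_ _⇒_ : Fm → Fm → Fm
  ex all : ℕ → Fm → Fm

elemB : ℕ → List ℕ → Bool
elemB x []       = false
elemB x (y ∷ ys) = (x ≡ᵇ y) ∨ elemB x ys

remove : ℕ → List ℕ → List ℕ
remove y = filter (λ v → Relation.Nullary.¬? (v ≟ y))

fv : Fm → List ℕ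
fv (atom p ts) = tsvars ts
fv ⊥'          = []
fv ⊤'          = []
fv (φ ∧' ψ)    = fv φ ++ fv ψ
fv (φ ∨' ψ)    = fv φ ++ fv ψ
fv (φ −< ψ)    = fv φ ++ fv ψ
fv (φ ⇒ ψ)     = fv φ ++ fv ψ
fv (ex x φ)    = remove x (fv φ)
fv (all x φ)   = remove x (fv φ)

avars : Fm → List ℕ
avars (atom p ts) = tsvars ts
avars ⊥'          = []
avars ⊤'          = []
avars (φ ∧' ψ)    = avars φ ++ avars ψ
avars (φ ∨' ψ)    = avars φ ++ avars ψ
avars (φ −< ψ)    = avars φ ++ avars ψ
avars (φ ⇒ ψ)     = avars φ ++ avars ψ
avars (ex x φ)    = x ∷ avars φ
avars (all x φ)   = x ∷ avars φ

maxL : List ℕ → ℕ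
maxL = foldr _⊔_ 0

update : (ℕ → Term) → ℕ → Term → (ℕ → Term)
update σ y t v = if v ≡ᵇ y then t else σ v

-- Capture-avoiding simultaneous substitution (Curry/Stoughton style):
-- a binder y is kept unless it would capture a variable of some σ v with
-- v free in the body (v ≠ y); in that case it is renamed to a variable
-- larger than every variable around.
mutual
  sub : (ℕ → Term) → Fm → Fm
  sub σ (atom p ts) = atom p (tssub σ ts)
  sub σ ⊥'          = ⊥'
  sub σ ⊤'          = ⊤'
  sub σ (φ ∧' ψ)    = sub σ φ ∧' sub σ ψ
  sub σ (φ ∨' ψ)    = sub σ φ ∨' sub σ ψ
  sub σ (φ −< ψ)    = sub σ φ −< sub σ ψ
  sub σ (φ ⇒ ψ)     = sub σ φ ⇒ sub σ ψ
  sub σ (ex y φ)    = ex (binder σ y φ) (sub (update σ y (var (binder σ y φ))) φ)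
  sub σ (all y φ)   = all (binder σ y φ) (sub (update σ y (var (binder σ y φ))) φ)

  binder : (ℕ → Term) → ℕ → Fm → ℕ
  binder σ y φ =
    if elemB y (concatMap (λ v → tvars (σ v)) (remove y (fv φ)))
    then suc (maxL (y ∷ avars φ ++ concatMap (λ v → tvars (σ v)) (fv φ)))
    else y

_[_/_] : Fm → Term → ℕ → Fm
φ [ t / x ] = sub (update var x t) φ

Rel : Set            -- relational atom  w R u  as (w , u)
Rel = ℕ × ℕ

Dom : Set            -- domain atom  w : x  as (w , x)
Dom = ℕ × ℕ

LF : Set
LF = ℕ × Fm

data Reach (R : List Rel) : ℕ → ℕ → Set where
  here : ∀ {w} → Reach R w w
  step : ∀ {w v u} → (w , v) ∈ R → Reach R v u → Reach R w u

InX : List Rel → List Dom → ℕ → ℕ → Set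
InX R T w x = ∃ λ u → (u , x) ∈ T × Reach R u w

Available : List Rel → List Dom → ℕ → Term → Set
Available R T w t = All (InX R T w) (tvars t)

data Cond : Set where
  ID CD : Cond

TermOK : Cond → List Rel → List Dom → ℕ → Term → Set
TermOK ID R T w t = Available R T w t
TermOK CD R T w t = ⊤

labelsR : List Rel → List ℕ
labelsR = concatMap (λ e → proj₁ e ∷ proj₂ e ∷ [])

labelsS : List Rel → List Dom → List LF → List LF → List ℕ
labelsS R T Γ Δ = labelsR R ++ map proj₁ T ++ map proj₁ Γ ++ map proj₁ Δ

varsS : List Dom → List LF → List LF → List ℕ
varsS T Γ Δ = map proj₂ T ++ concatMap (λ l → avars (proj₂ l)) Γ
                          ++ concatMap (λ l → avars (proj₂ l)) Δ

FreshL : ℕ → List Rel → List Dom → List LF → List LF → Set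
FreshL u R T Γ Δ = u ∉ labelsS R T Γ Δ

FreshV : ℕ → List Dom → List LF → List LF → Set
FreshV y T Γ Δ = y ∉ varsS T Γ Δ

domAtoms : ℕ → List Term → List Dom
domAtoms w ts = map (λ x → (w , x)) (deduplicate _≟_ (tsvars ts))

-- Multisets are lists;
-- a principal formula that is consumed is located by a permutation
-- Γ ↭ (w , φ) ∷ Γ', one that is kept in the premises by membership.
-- All side conditions refer to the conclusion.

data Der (C : Cond) : List Rel → List Dom → List LF → List LF → Set where
  ax  : ∀ {R T Γ Δ w u p ts} → (w , atom p ts) ∈ Γ → (u , atom p ts) ∈ Δ →
        Reach R w u → Der C R T Γ Δ
  ⊥L  : ∀ {R T Γ Δ w} → (w , ⊥') ∈ Γ → Der C R T Γ Δ
  ⊤R  : ∀ {R T Γ Δ w} → (w , ⊤') ∈ Δ → Der C R T Γ Δ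
  ∧L  : ∀ {R T Γ Γ' Δ w φ ψ} → Γ ↭ (w , φ ∧' ψ) ∷ Γ' →
        Der C R T ((w , φ) ∷ (w , ψ) ∷ Γ') Δ → Der C R T Γ Δ
  ∧R  : ∀ {R T Γ Δ Δ' w φ ψ} → Δ ↭ (w , φ ∧' ψ) ∷ Δ' →
        Der C R T Γ ((w , φ) ∷ Δ') → Der C R T Γ ((w , ψ) ∷ Δ') → Der C R T Γ Δ
  ∨L  : ∀ {R T Γ Γ' Δ w φ ψ} → Γ ↭ (w , φ ∨' ψ) ∷ Γ' →
        Der C R T ((w , φ) ∷ Γ') Δ → Der C R T ((w , ψ) ∷ Γ') Δ → Der C R T Γ Δ
  ∨R  : ∀ {R T Γ Δ Δ' w φ ψ} → Δ ↭ (w , φ ∨' ψ) ∷ Δ' →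
        Der C R T Γ ((w , φ) ∷ (w , ψ) ∷ Δ') → Der C R T Γ Δ
  ⇒L  : ∀ {R T Γ Δ w u φ ψ} → (w , φ ⇒ ψ) ∈ Γ → Reach R w u →
        Der C R T Γ ((u , φ) ∷ Δ) → Der C R T ((u , ψ) ∷ Γ) Δ → Der C R T Γ Δ
  ⇒R  : ∀ {R T Γ Δ Δ' w u φ ψ} → Δ ↭ (w , φ ⇒ ψ) ∷ Δ' → FreshL u R T Γ Δ →
        Der C ((w , u) ∷ R) T ((u , φ) ∷ Γ) ((u , ψ) ∷ Δ') → Der C R T Γ Δ
  −<L : ∀ {R T Γ Γ' Δ w u φ ψ} → Γ ↭ (w , φ −< ψ) ∷ Γ' → FreshL u R T Γ Δ →
        Der C ((u , w) ∷ R) T ((u , φ) ∷ Γ') ((u , ψ) ∷ Δ) → Der C R T Γ Δ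
  −<R : ∀ {R T Γ Δ w u φ ψ} → (u , φ −< ψ) ∈ Δ → Reach R w u →
        Der C R T Γ ((w , φ) ∷ Δ) → Der C R T ((w , ψ) ∷ Γ) Δ → Der C R T Γ Δ
  ∃L  : ∀ {R T Γ Γ' Δ w x y φ} → Γ ↭ (w , ex x φ) ∷ Γ' → FreshV y T Γ Δ →
        Der C R ((w , y) ∷ T) ((w , φ [ var y / x ]) ∷ Γ') Δ → Der C R T Γ Δ
  ∃R  : ∀ {R T Γ Δ w x φ t} → (w , ex x φ) ∈ Δ → TermOK C R T w t →
        Der C R T Γ ((w , φ [ t / x ]) ∷ Δ) → Der C R T Γ Δ
  ∀L  : ∀ {R T Γ Δ w u x φ t} → (w , all x φ) ∈ Γ → Reach R w u → TermOK C R T u t →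
        Der C R T ((u , φ [ t / x ]) ∷ Γ) Δ → Der C R T Γ Δ
  ∀R  : ∀ {R T Γ Δ Δ' w u x y φ} → Δ ↭ (w , all x φ) ∷ Δ' →
        FreshL u R T Γ Δ → FreshV y T Γ Δ →
        Der C ((w , u) ∷ R) ((u , y) ∷ T) Γ ((u , φ [ var y / x ]) ∷ Δ') → Der C R T Γ Δ
  ds  : ∀ {R T Γ Δ w p ts} → C ≡ ID → (w , atom p ts) ∈ Γ →
        Der C R (domAtoms w ts ++ T) Γ Δ → Der C R T Γ Δ

height : ∀ {C R T Γ Δ} → Der C R T Γ Δ → ℕ
height (ax _ _ _)      = 0
height (⊥L _)          = 0
height (⊤R _)          = 0
height (∧L _ d)        = suc (height d)
height (∧R _ d e)      = suc (height d ⊔ height e)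
height (∨L _ d e)      = suc (height d ⊔ height e)
height (∨R _ d)        = suc (height d)
height (⇒L _ _ d e)    = suc (height d ⊔ height e)
height (⇒R _ _ d)      = suc (height d)
height (−<L _ _ d)     = suc (height d)
height (−<R _ _ d e)   = suc (height d ⊔ height e)
height (∃L _ _ d)      = suc (height d)
height (∃R _ _ d)      = suc (height d)
height (∀L _ _ _ d)    = suc (height d)
height (∀R _ _ _ d)    = suc (height d)
height (ds _ _ d)      = suc (height d)

data UWalk (R : List Rel) : ℕ → ℕ → List (Fin (length R)) → Set where
  nil : ∀ {v} → UWalk R v v []
  fwd : ∀ {v v' v'' is} (i : Fin (length R)) → lookup R i ≡ (v , v') →
        UWalk R v' v'' is → UWalk R v v'' (i ∷ is)
  bwd : ∀ {v v' v'' is} (i : Fin (length R)) → lookup R i ≡ (v' , v) →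
        UWalk R v' v'' is → UWalk R v v'' (i ∷ is)

data DWalk (R : List Rel) : ℕ → ℕ → List (Fin (length R)) → Set where
  nil : ∀ {v} → DWalk R v v []
  fwd : ∀ {v v' v'' is} (i : Fin (length R)) → lookup R i ≡ (v , v') →
        DWalk R v' v'' is → DWalk R v v'' (i ∷ is)

UCycle : List Rel → Set
UCycle R = ∃ λ v → ∃ λ is → is ≢ [] × Unique is × UWalk R v v is

DCycle : List Rel → Set
DCycle R = ∃ λ v → ∃ λ is → is ≢ [] × Unique is × DWalk R v v is

Connected : List Rel → Set
Connected R = ∀ v v' → v ∈ labelsR R → v' ∈ labelsR R → ∃ λ is → UWalk R v v' is

IsSequent : List Rel → List Dom → List LF → List LF → Set
IsSequent R T Γ Δ =
  (R ≢ [] → All (λ v → v ∈ labelsR R) (map proj₁ T ++ map proj₁ Γ ++ map proj₁ Δ)) ×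
  (R ≡ [] → ∃ λ v → (map proj₁ T ++ map proj₁ Γ ++ map proj₁ Δ) ≢ [] ×
                     All (λ v' → v' ≡ v) (map proj₁ T ++ map proj₁ Γ ++ map proj₁ Δ)) ×
  Connected R × ¬ DCycle R × ¬ UCycle R

module Submission where

-- We prove more than (lft): the labels of any number of antecedent formulae and domain
-- atoms may be moved down to R'-predecessors, where R' is any relation that reaches at
-- least as far as R and has no new labels.  The generalisation is needed because
-- (−<L) on a lowered formula w : φ −< ψ must add the edge u R w' instead of u R w, and
-- (∃L), (ds) and (∀R) introduce domain atoms whose label gets lowered as well.  Every
-- side condition transfers: reachability conditions compose with the lowering, the
-- conclusion's labels and variables can only shrink, and availability is closed
-- under moving domain atoms down.  The derivation is rebuilt rule by rule with the
-- same shape, so the height does not grow.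

open import Defs
open import Data.Nat using (ℕ; _≤_; z≤n; s≤s; _≟_)
open import Data.Nat.Properties using (⊔-mono-≤)
open import Data.List using (List; []; _∷_; _++_; map; concat; deduplicate)
open import Data.List.Membership.Propositional using (_∈_)
open import Data.List.Membership.Propositional.Properties using (∈-++⁺ˡ; ∈-++⁺ʳ; ∈-++⁻; ∈-concatMap⁺)
open import Data.List.Relation.Binary.Subset.Propositional using (_⊆_)
open import Data.List.Relation.Binary.Permutation.Propositional using (_↭_; refl; prep; swap; trans)
open import Data.List.Relation.Binary.Pointwise as Pointwise using (Pointwise; []; _∷_)
import Data.List.Relation.Unary.All as All
open import Data.List.Relation.Unary.Any as Any using (here; there)
open import Data.Product using (Σ; ∃; _×_; _,_; proj₁; proj₂)
open import Data.Sum using (inj₁; inj₂; [_,_])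
open import Function using (_∘_; id)
open import Relation.Binary.PropositionalEquality as ≡ using (_≡_; cong; cong₂; subst)

private
  variable
    A B : Set
    R R' : List Rel
    a v v' w w' : ℕ

Reach-trans : Reach R a v → Reach R v w → Reach R a w
Reach-trans here q       = q
Reach-trans (step e p) q = step e (Reach-trans p q)

Reach-weaken : ∀ {e} → Reach R v w → Reach (e ∷ R) v w
Reach-weaken here       = here
Reach-weaken (step e p) = step (there e) (Reach-weaken p)

source∈labelsR : (v , w) ∈ R → v ∈ labelsR R
source∈labelsR e = ∈-concatMap⁺ _ (Any.map (λ { ≡.refl → here ≡.refl }) e)

record Refines (R R' : List Rel) : Set where
  field
    reach   : Reach R v w → Reach R' v w
    labels⊆ : labelsR R' ⊆ labelsR R
open Refines

Refines-refl : Refines R R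
Refines-refl = record { reach = id ; labels⊆ = id }

Refines-redirect : Refines R R' → Reach R' w' w → Refines ((v , w) ∷ R) ((v , w') ∷ R')
Refines-redirect {R} {R'} {w'} {w} {v} ρ w'↠w = record { reach = reach' ; labels⊆ = labels' }
  where
  reach' : Reach ((v , w) ∷ R) a v' → Reach ((v , w') ∷ R') a v'
  reach' here                      = here
  reach' (step (here ≡.refl) p)  =
    step (here ≡.refl) (Reach-trans (Reach-weaken w'↠w) (reach' p))
  reach' (step (there e) p)        = Reach-trans (Reach-weaken (reach ρ (step e here))) (reach' p)

  labels' : labelsR ((v , w') ∷ R') ⊆ labelsR ((v , w) ∷ R)
  labels' (here eq)                = here eq
  labels' (there (there m))        = there (there (labels⊆ ρ m))
  labels' (there (here ≡.refl))  = target w'↠w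
    where
    target : ∀ {x} → Reach R' x w → x ∈ labelsR ((v , w) ∷ R)
    target here       = there (here ≡.refl)
    target (step e _) = there (there (labels⊆ ρ (source∈labelsR e)))

data Lower {A : Set} (R : List Rel) : ℕ × A → ℕ × A → Set where
  lower : ∀ {x} → Reach R v' v → Lower R (v , x) (v' , x)

Lowered : {A : Set} → List Rel → List (ℕ × A) → List (ℕ × A) → Set
Lowered R = Pointwise (Lower R)

Lowered-refl : (xs : List (ℕ × A)) → Lowered R xs xs
Lowered-refl _ = Pointwise.refl (lower here)

Lowered-weaken : ∀ {e} {xs ys : List (ℕ × A)} → Lowered R xs ys → Lowered (e ∷ R) xs ys
Lowered-weaken = Pointwise.map (λ { (lower r) → lower (Reach-weaken r) })

Lowered-∈ : ∀ {xs ys : List (ℕ × A)} {x} → Lowered R xs ys → (v , x) ∈ xs →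
            ∃ λ v' → (v' , x) ∈ ys × Reach R v' v
Lowered-∈ (lower r ∷ _) (here ≡.refl) = _ , here ≡.refl , r
Lowered-∈ (_ ∷ p) (there m) with Lowered-∈ p m
... | v' , m' , r = v' , there m' , r

Lowered-↭ : ∀ {xs zs ys : List (ℕ × A)} → xs ↭ zs → Lowered R xs ys →
            ∃ λ ws → ys ↭ ws × Lowered R zs ws
Lowered-↭ refl p = _ , refl , p
Lowered-↭ (prep _ π) (q ∷ p) with Lowered-↭ π p
... | _ , π' , p' = _ , prep _ π' , q ∷ p'
Lowered-↭ (swap _ _ π) (q ∷ q' ∷ p) with Lowered-↭ π p
... | _ , π' , p' = _ , swap _ _ π' , q' ∷ q ∷ p'
Lowered-↭ (trans π₁ π₂) p with Lowered-↭ π₁ p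
... | _ , π₁' , p₁ with Lowered-↭ π₂ p₁
... | _ , π₂' , p₂ = _ , trans π₁' π₂' , p₂

Lowered-map-proj₂ : (f : A → B) {xs ys : List (ℕ × A)} → Lowered R xs ys →
                    map (f ∘ proj₂) ys ≡ map (f ∘ proj₂) xs
Lowered-map-proj₂ f []            = ≡.refl
Lowered-map-proj₂ f (lower _ ∷ p) = cong (_ ∷_) (Lowered-map-proj₂ f p)

Lowered-labels : {xs ys : List (ℕ × A)} → Lowered R xs ys → map proj₁ ys ⊆ labelsR R ++ map proj₁ xs
Lowered-labels {R = R} (lower here ∷ _)       (here ≡.refl) = ∈-++⁺ʳ (labelsR R) (here ≡.refl)
Lowered-labels         (lower (step e _) ∷ _) (here ≡.refl) = ∈-++⁺ˡ (source∈labelsR e)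
Lowered-labels {R = R} (_ ∷ p)                (there m)       =
  [ ∈-++⁺ˡ , ∈-++⁺ʳ (labelsR R) ∘ there ] (∈-++⁻ (labelsR R) (Lowered-labels p m))

Lowered-domAtoms : Reach R w' w → (xs : List ℕ) →
                   Lowered R (map (w ,_) xs) (map (w' ,_) xs)
Lowered-domAtoms r []       = []
Lowered-domAtoms r (_ ∷ xs) = lower r ∷ Lowered-domAtoms r xs

module _ {R R' : List Rel} {T T' : List Dom} (ρ : Refines R R') (pT : Lowered R' T T') where

  InX-transfer : ∀ {x} → InX R T w x → InX R' T' w x
  InX-transfer (_ , m , r) with Lowered-∈ pT m
  ... | _ , m' , r' = _ , m' , Reach-trans r' (reach ρ r)

  TermOK-transfer : ∀ {C t} → TermOK C R T w t → TermOK C R' T' w t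
  TermOK-transfer {C = ID} = All.map InX-transfer
  TermOK-transfer {C = CD} = id

  module _ {Γ Γ' : List LF} (pΓ : Lowered R' Γ Γ') where

    labelsS-⊆ : ∀ {Δ} → labelsS R' T' Γ' Δ ⊆ labelsS R T Γ Δ
    labelsS-⊆ m with ∈-++⁻ (labelsR R') m
    ... | inj₁ l = ∈-++⁺ˡ (labels⊆ ρ l)
    ... | inj₂ m₁ with ∈-++⁻ (map proj₁ T') m₁
    ...   | inj₁ t = [ ∈-++⁺ˡ ∘ labels⊆ ρ , ∈-++⁺ʳ (labelsR R) ∘ ∈-++⁺ˡ ]
                       (∈-++⁻ (labelsR R') (Lowered-labels pT t))
    ...   | inj₂ m₂ with ∈-++⁻ (map proj₁ Γ') m₂
    ...     | inj₁ g = [ ∈-++⁺ˡ ∘ labels⊆ ρ , ∈-++⁺ʳ (labelsR R) ∘ ∈-++⁺ʳ (map proj₁ T) ∘ ∈-++⁺ˡ ]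
                         (∈-++⁻ (labelsR R') (Lowered-labels pΓ g))
    ...     | inj₂ d = ∈-++⁺ʳ (labelsR R) (∈-++⁺ʳ (map proj₁ T) (∈-++⁺ʳ (map proj₁ Γ) d))

    FreshL-transfer : ∀ {u Δ} → FreshL u R T Γ Δ → FreshL u R' T' Γ' Δ
    FreshL-transfer fresh = fresh ∘ labelsS-⊆

    varsS-lowered : ∀ {Δ} → varsS T' Γ' Δ ≡ varsS T Γ Δ
    varsS-lowered = cong₂ _++_ (Lowered-map-proj₂ id pT)
                               (cong (λ L → concat L ++ _) (Lowered-map-proj₂ avars pΓ))

    FreshV-transfer : ∀ {y} Δ → FreshV y T Γ Δ → FreshV y T' Γ' Δ
    FreshV-transfer Δ fresh = fresh ∘ subst (_ ∈_) (varsS-lowered {Δ})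

lower-admissible : ∀ {C R R' T T' Γ Γ' Δ} → Refines R R' → Lowered R' T T' → Lowered R' Γ Γ' →
                   (d : Der C R T Γ Δ) → Σ (Der C R' T' Γ' Δ) (λ d' → height d' ≤ height d)
lower-admissible ρ pT pΓ (ax m m' r) with Lowered-∈ pΓ m
... | _ , m″ , r' = ax m″ m' (Reach-trans r' (reach ρ r)) , z≤n
lower-admissible ρ pT pΓ (⊥L m) with Lowered-∈ pΓ m
... | _ , m' , _ = ⊥L m' , z≤n
lower-admissible ρ pT pΓ (⊤R m) = ⊤R m , z≤n
lower-admissible ρ pT pΓ (∧L π d) with Lowered-↭ π pΓ
... | _ , π' , lower r ∷ p with lower-admissible ρ pT (lower r ∷ lower r ∷ p) d
... | d' , h = ∧L π' d' , s≤s h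
lower-admissible ρ pT pΓ (∧R π d e) with lower-admissible ρ pT pΓ d | lower-admissible ρ pT pΓ e
... | d' , h | e' , h' = ∧R π d' e' , s≤s (⊔-mono-≤ h h')
lower-admissible ρ pT pΓ (∨L π d e) with Lowered-↭ π pΓ
... | _ , π' , lower r ∷ p with lower-admissible ρ pT (lower r ∷ p) d | lower-admissible ρ pT (lower r ∷ p) e
... | d' , h | e' , h' = ∨L π' d' e' , s≤s (⊔-mono-≤ h h')
lower-admissible ρ pT pΓ (∨R π d) with lower-admissible ρ pT pΓ d
... | d' , h = ∨R π d' , s≤s h
lower-admissible ρ pT pΓ (⇒L m r d e) with Lowered-∈ pΓ m
... | _ , m' , r' with lower-admissible ρ pT pΓ d | lower-admissible ρ pT (lower here ∷ pΓ) e
... | d' , h | e' , h' = ⇒L m' (Reach-trans r' (reach ρ r)) d' e' , s≤s (⊔-mono-≤ h h')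
lower-admissible ρ pT pΓ (⇒R π fresh d)
  with lower-admissible (Refines-redirect ρ here) (Lowered-weaken pT) (lower here ∷ Lowered-weaken pΓ) d
... | d' , h = ⇒R π (FreshL-transfer ρ pT pΓ fresh) d' , s≤s h
lower-admissible ρ pT pΓ (−<L π fresh d) with Lowered-↭ π pΓ
... | _ , π' , lower r ∷ p
  with lower-admissible (Refines-redirect ρ r) (Lowered-weaken pT) (lower here ∷ Lowered-weaken p) d
... | d' , h = −<L π' (FreshL-transfer ρ pT pΓ fresh) d' , s≤s h
lower-admissible ρ pT pΓ (−<R m r d e) with lower-admissible ρ pT pΓ d | lower-admissible ρ pT (lower here ∷ pΓ) e
... | d' , h | e' , h' = −<R m (reach ρ r) d' e' , s≤s (⊔-mono-≤ h h')
lower-admissible {Δ = Δ} ρ pT pΓ (∃L π fresh d) with Lowered-↭ π pΓ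
... | _ , π' , lower r ∷ p with lower-admissible ρ (lower r ∷ pT) (lower r ∷ p) d
... | d' , h = ∃L π' (FreshV-transfer ρ pT pΓ Δ fresh) d' , s≤s h
lower-admissible ρ pT pΓ (∃R m ok d) with lower-admissible ρ pT pΓ d
... | d' , h = ∃R m (TermOK-transfer ρ pT ok) d' , s≤s h
lower-admissible ρ pT pΓ (∀L m r ok d) with Lowered-∈ pΓ m
... | _ , m' , r' with lower-admissible ρ pT (lower here ∷ pΓ) d
... | d' , h = ∀L m' (Reach-trans r' (reach ρ r)) (TermOK-transfer ρ pT ok) d' , s≤s h
lower-admissible {Δ = Δ} ρ pT pΓ (∀R π freshL freshV d)
  with lower-admissible (Refines-redirect ρ here) (lower here ∷ Lowered-weaken pT) (Lowered-weaken pΓ) d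
... | d' , h = ∀R π (FreshL-transfer ρ pT pΓ freshL) (FreshV-transfer ρ pT pΓ Δ freshV) d' , s≤s h
lower-admissible ρ pT pΓ (ds {ts = ts} c m d) with Lowered-∈ pΓ m
... | _ , m' , r
  with lower-admissible ρ (Pointwise.++⁺ (Lowered-domAtoms r (deduplicate _≟_ (tsvars ts))) pT) pΓ d
... | d' , h = ds c m' d' , s≤s h

lemma38 : (C : Cond) (R : List Rel) (T : List Dom) (Γ Δ : List LF) (w u : ℕ) (φ : Fm) →
    IsSequent R T ((u , φ) ∷ Γ) Δ → Reach R w u →
    (d : Der C R T ((u , φ) ∷ Γ) Δ) →
    Σ (Der C R T ((w , φ) ∷ Γ) Δ) (λ d' → height d' ≤ height d)
lemma38 C R T Γ Δ w u φ _ w↠u = lower-admissible Refines-refl (Lowered-refl T) (lower w↠u ∷ Lowered-refl Γ)
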